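{- Let $G$ be a finite simple graph, $k$ a positive integer and $\{u,v\}\in E(G)$. For every total order $\pi$ of the variables $\{x_i[uv],x_i[vu]\mid i\in[k]\}$, the constraint $\chi_{uv}=\Big(\big(\sum_{i\in[k]}x_i[uv]=1\big)\land\big(\sum_{i\in[k]}x_i[vu]=1\big)\Big)\lor\bigwedge_{i\in[k]}\big(x_i[uv]=x_i[vu]=0\big)$ can be represented by a complete $\pi$-OBDD of width at most $8$.
   Context: $x_i[uv],x_i[vu]$ ($i\in[k]$) are Boolean variables; sums are over integers. A $\pi$-OBDD is a binary decision diagram (DAG with one source, sinks $0$ and $1$, decision nodes labelled by variables with $0$- and $1$-children) in which variables appear at most once and in an order consistent with $\pi$ along every root-to-sink path; it is complete if every such path tests every variable. Its width is the maximum number of nodes labelled by the same variable. -}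

module Defs where

open import Data.Nat using (ℕ; zero; suc; _+_; _≤_; _<_)
open import Data.Bool using (Bool; true; false; if_then_else_)
open import Data.Fin as F using (Fin)
import Data.Fin.Properties as FP
open import Data.Sum using (_⊎_; inj₁; inj₂)
open import Data.Sum.Properties using (≡-dec)
open import Data.List using (List; []; _∷_; map; allFin)
open import Data.Nat.ListAction using (sum)
open import Data.List.Membership.Propositional using (_∈_)
open import Data.List.Relation.Unary.Linked using (Linked)
open import Data.Product using (Σ; _×_; _,_)
open import Relation.Nullary using (yes; no; ¬_)
open import Relation.Binary.PropositionalEquality using (_≡_)
open import Function.Bundles using (_⤖_; _⇔_; Bijection)

record SimpleGraph (n : ℕ) : Set₁ where
  field
    Adj   : Fin n → Fin n → Set
    sym   : ∀ {u v} → Adj u v → Adj v u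
    irrefl : ∀ {u} → ¬ Adj u u

-- Variables of the edge constraint for a fixed edge {u,v}:
--   inj₁ i  stands for  x_i[uv],   inj₂ i  stands for  x_i[vu]   (i ∈ [k] ≅ Fin k)

Var : ℕ → Set
Var k = Fin k ⊎ Fin k

TotalOrder : ℕ → Set
TotalOrder k = Var k ⤖ Fin (k + k)

pos : ∀ {k} → TotalOrder k → Var k → Fin (k + k)
pos π = Bijection.to π

_<[_]_ : ∀ {k} → Var k → TotalOrder k → Var k → Set
x <[ π ] y = pos π x F.< pos π y

-- The constraint χ_uv (sums over integers; here naturals, as all terms are 0/1)

bit : Bool → ℕ
bit true = 1
bit false = 0

sumFin : ∀ k → (Fin k → ℕ) → ℕ
sumFin k f = sum (map f (allFin k))

χ : ∀ k → (Var k → Bool) → Set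
χ k α =
  (sumFin k (λ i → bit (α (inj₁ i))) ≡ 1 × sumFin k (λ i → bit (α (inj₂ i))) ≡ 1)
  ⊎ (∀ (i : Fin k) → α (inj₁ i) ≡ false × α (inj₂ i) ≡ false)

data Node (V : Set) (N : ℕ) : Set where
  sink : Bool → Node V N
  dec  : V → Fin N → Fin N → Node V N   -- variable, 0-child, 1-child

module Diagram {V : Set} {N : ℕ} (node : Fin N → Node V N) where

  data Edge : Fin N → Fin N → Set where
    edge₀ : ∀ {a x l h} → node a ≡ dec x l h → Edge a l
    edge₁ : ∀ {a x l h} → node a ≡ dec x l h → Edge a h

  data Reach : Fin N → Fin N → Set where
    here : ∀ {a} → Reach a a
    step : ∀ {a b c} → Edge a b → Reach b c → Reach a c

  data PathVars : Fin N → List V → Set where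
    atSink : ∀ {a b} → node a ≡ sink b → PathVars a []
    go₀    : ∀ {a x l h xs} → node a ≡ dec x l h → PathVars l xs → PathVars a (x ∷ xs)
    go₁    : ∀ {a x l h xs} → node a ≡ dec x l h → PathVars h xs → PathVars a (x ∷ xs)

  data Eval (α : V → Bool) : Fin N → Bool → Set where
    stop : ∀ {a b} → node a ≡ sink b → Eval α a b
    next : ∀ {a x l h b} → node a ≡ dec x l h →
           Eval α (if α x then h else l) b → Eval α a b

record BDD (V : Set) : Set where
  field
    N     : ℕ
    node  : Fin N → Node V N
    root  : Fin N
  open Diagram node public
  field
    -- acyclic (a DAG): a rank strictly decreasing along edges
    rank     : Fin N → ℕ
    rank-dec : ∀ {a b} → Edge a b → rank b < rank a
    -- one source: every node is reachable from the root
    source   : ∀ a → Reach root a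
    -- the sinks are 0 and 1 (at most one sink node per value)
    sink-uniq : ∀ {a c b} → node a ≡ sink b → node c ≡ sink b → a ≡ c

Represents : ∀ {V} → BDD V → ((V → Bool) → Set) → Set
Represents B P = ∀ α → Σ Bool λ b → BDD.Eval B α (BDD.root B) b × (b ≡ true ⇔ P α)

-- π-OBDD: along every root-to-sink path the tested variables are strictly
-- increasing w.r.t. π (hence each appears at most once)
IsOBDD : ∀ {k} → TotalOrder k → BDD (Var k) → Set
IsOBDD π B = ∀ xs → BDD.PathVars B (BDD.root B) xs → Linked (λ x y → x <[ π ] y) xs

IsComplete : ∀ {V} → BDD V → Set
IsComplete B = ∀ xs → BDD.PathVars B (BDD.root B) xs → ∀ x → x ∈ xs

labelledBy : ∀ {k N} → Var k → Node (Var k) N → ℕ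
labelledBy x (sink _) = 0
labelledBy x (dec y _ _) with ≡-dec FP._≟_ FP._≟_ x y
... | yes _ = 1
... | no _ = 0

count : ∀ {k} → BDD (Var k) → Var k → ℕ
count B x = sumFin (BDD.N B) (λ a → labelledBy x (BDD.node B a))

Width≤ : ∀ {k} → BDD (Var k) → ℕ → Set
Width≤ B w = ∀ x → count B x ≤ w

-- χ_uv is recognised by a five-state automaton that reads the 2k variables in π-order: its state
-- records whether zero or one of the x_i[uv] and zero or one of the x_i[vu] read so far are 1,
-- with one absorbing state once either side has two, and it accepts when both sides have the same
-- count.  Unrolling the automaton along π, level by level, and keeping on each level only the
-- states reachable from the start gives a complete π-OBDD with at most five nodes per variable.
-- Both sinks are reachable because χ_uv is not constant when k ≥ 1: the all-zero assignment
-- satisfies it, and setting every x_i[uv] to 1 and every x_i[vu] to 0 does not.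

module Submission where

open import Defs
open import Data.Bool using (Bool; true; false; if_then_else_)
import Data.Bool.Properties as Bool
open import Data.Empty using (⊥-elim)
open import Data.Fin as F using (Fin; toℕ; _↑ˡ_; _↑ʳ_; splitAt)
import Data.Fin.Properties as FP
open import Data.List using (List; []; _∷_; _++_; map; filter; length; lookup; allFin; tabulate; [_])
import Data.List.Properties as List
open import Data.List.Membership.Propositional using (_∈_; _∉_)
open import Data.List.Membership.Propositional.Properties
  using (∈-map⁺; ∈-map⁻; ∈-++⁺ˡ; ∈-++⁺ʳ; ∈-++⁻; ∈-filter⁺; ∈-filter⁻; ∈-lookup; ∈-allFin)
  renaming (∈-tabulate⁺ to ∈-tabulate; ∈-length to ∈⇒length>0)
open import Data.List.Membership.Propositional.Properties.WithK
  using (unique⇒irrelevant; unique∧set⇒bag)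
import Data.List.Membership.DecPropositional as DecMembership
open import Data.List.Relation.Unary.Any using (here; there; index)
open import Data.List.Relation.Unary.Any.Properties using (lookup-index)
open import Data.List.Relation.Unary.All using ([])
open import Data.List.Relation.Unary.All.Properties using (All¬⇒¬Any)
open import Data.List.Relation.Unary.AllPairs using ([]; _∷_)
open import Data.List.Relation.Unary.AllPairs.Properties using (tabulate⁺-<)
open import Data.List.Relation.Unary.Linked using (Linked)
open import Data.List.Relation.Unary.Linked.Properties using (AllPairs⇒Linked)
open import Data.List.Relation.Unary.Unique.Propositional using (Unique)
import Data.List.Relation.Unary.Unique.Propositional.Properties as Unique
open import Data.List.Relation.Binary.Permutation.Propositional using (_↭_)
import Data.List.Relation.Binary.Permutation.Propositional.Properties as Perm
open import Data.List.Relation.Binary.BagAndSetEquality using (∼bag⇒↭)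
open import Data.Maybe using (Maybe; just; nothing)
import Data.Maybe.Properties as Maybe
import Data.Product.Properties as Product
open import Data.Nat using (ℕ; zero; suc; _+_; _∸_; _≤_; _<_; z≤n; s≤s)
open import Data.Nat.Properties
open import Data.Nat.ListAction using (sum)
open import Data.Nat.ListAction.Properties using (sum-++; sum-↭)
open import Data.Product using (Σ; _×_; _,_; proj₁; proj₂)
open import Data.Sum using (_⊎_; inj₁; inj₂; [_,_]′)
open import Data.Sum.Properties using (≡-dec; inj₁-injective; inj₂-injective)
open import Function using (_∘_; id; _⇔_; mk⇔; Equivalence; Inverse)
open import Function.Properties.Bijection using (Bijection⇒Inverse)
import Function.Properties.Equivalence as ⇔
open import Relation.Binary.PropositionalEquality hiding ([_])
open import Relation.Binary.Definitions using (DecidableEquality)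
open import Relation.Nullary using (¬_; yes; no)
open import Relation.Nullary.Decidable using (from-yes)

data Split (m n : ℕ) : Fin (m + n) → Set where
  left  : (i : Fin m) → Split m n (i ↑ˡ n)
  right : (j : Fin n) → Split m n (m ↑ʳ j)

split : ∀ m n (a : Fin (m + n)) → Split m n a
split zero    n a         = right a
split (suc m) n F.zero    = left F.zero
split (suc m) n (F.suc a) with split m n a
... | left i  = left (F.suc i)
... | right j = right j

index-∈-lookup : ∀ {A : Set} (xs : List A) i → index (∈-lookup {xs = xs} i) ≡ i
index-∈-lookup (x ∷ xs) F.zero    = refl
index-∈-lookup (x ∷ xs) (F.suc i) = cong F.suc (index-∈-lookup xs i)

sumFin-cong : ∀ n {f g : Fin n → ℕ} → (∀ i → f i ≡ g i) → sumFin n f ≡ sumFin n g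
sumFin-cong n f≗g = cong sum (List.map-cong f≗g (allFin n))

sumFin-suc : ∀ n (f : Fin (suc n) → ℕ) → sumFin (suc n) f ≡ f F.zero + sumFin n (f ∘ F.suc)
sumFin-suc n f = cong (λ xs → f F.zero + sum xs)
  (trans (List.map-tabulate F.suc f) (sym (List.map-tabulate id (f ∘ F.suc))))

sumFin-+ : ∀ m n (f : Fin (m + n) → ℕ) →
           sumFin (m + n) f ≡ sumFin m (f ∘ (_↑ˡ n)) + sumFin n (f ∘ (m ↑ʳ_))
sumFin-+ zero    n f = refl
sumFin-+ (suc m) n f = begin
  sumFin (suc m + n) f                                ≡⟨ sumFin-suc (m + n) f ⟩
  f F.zero + sumFin (m + n) (f ∘ F.suc)               ≡⟨ cong (f F.zero +_) (sumFin-+ m n (f ∘ F.suc)) ⟩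
  f F.zero + (sumFin m (f ∘ F.suc ∘ (_↑ˡ n)) + rest)  ≡⟨ +-assoc (f F.zero) _ rest ⟨
  f F.zero + sumFin m (f ∘ F.suc ∘ (_↑ˡ n)) + rest    ≡⟨ cong (_+ rest) (sumFin-suc m (f ∘ (_↑ˡ n))) ⟨
  sumFin (suc m) (f ∘ (_↑ˡ n)) + rest                 ∎
  where
  open ≡-Reasoning
  rest = sumFin n (f ∘ (suc m ↑ʳ_))

sumFin-zero : ∀ n {f : Fin n → ℕ} → (∀ i → f i ≡ 0) → sumFin n f ≡ 0
sumFin-zero zero    f≡0 = refl
sumFin-zero (suc n) {f} f≡0 =
  trans (sumFin-suc n f) (cong₂ _+_ (f≡0 F.zero) (sumFin-zero n (f≡0 ∘ F.suc)))

sumFin≡0⇒zero : ∀ n {f : Fin n → ℕ} → sumFin n f ≡ 0 → ∀ i → f i ≡ 0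
sumFin≡0⇒zero (suc n) {f} Σ≡0 F.zero    = m+n≡0⇒m≡0 (f F.zero) (trans (sym (sumFin-suc n f)) Σ≡0)
sumFin≡0⇒zero (suc n) {f} Σ≡0 (F.suc i) =
  sumFin≡0⇒zero n (m+n≡0⇒n≡0 (f F.zero) (trans (sym (sumFin-suc n f)) Σ≡0)) i

sumFin-≤ : ∀ n {f : Fin n → ℕ} → (∀ i → f i ≤ 1) → sumFin n f ≤ n
sumFin-≤ zero    f≤1 = z≤n
sumFin-≤ (suc n) {f} f≤1 = begin
  sumFin (suc n) f                ≡⟨ sumFin-suc n f ⟩
  f F.zero + sumFin n (f ∘ F.suc) ≤⟨ +-mono-≤ (f≤1 F.zero) (sumFin-≤ n (f≤1 ∘ F.suc)) ⟩
  suc n                           ∎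
  where open ≤-Reasoning

bit≡0 : ∀ {b} → bit b ≡ 0 → b ≡ false
bit≡0 {false} _ = refl

sumFin-bit≡0⇔ : ∀ n (f : Fin n → Bool) → sumFin n (bit ∘ f) ≡ 0 ⇔ (∀ i → f i ≡ false)
sumFin-bit≡0⇔ n f = mk⇔ (λ Σ≡0 → bit≡0 ∘ sumFin≡0⇒zero n Σ≡0) (sumFin-zero n ∘ (cong bit ∘_))

dec≢sink : ∀ {V : Set} {N x l h b} → dec x l h ≢ sink {V} {N} b
dec≢sink ()

module _ {V : Set} {N : ℕ} {node : Fin N → Node V N} where
  open Diagram node

  edge-dec : ∀ {a y} (c : Bool → Fin N) → node a ≡ dec y (c false) (c true) → ∀ β → Edge a (c β)
  edge-dec c e false = edge₀ e
  edge-dec c e true  = edge₁ e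

  edge-dec⁻ : ∀ {a b y} (c : Bool → Fin N) → node a ≡ dec y (c false) (c true) →
              Edge a b → Σ Bool λ β → b ≡ c β
  edge-dec⁻ c e (edge₀ e′) with trans (sym e) e′
  ... | refl = false , refl
  edge-dec⁻ c e (edge₁ e′) with trans (sym e) e′
  ... | refl = true , refl

  eval-dec : ∀ {α a y b} (c : Bool → Fin N) → node a ≡ dec y (c false) (c true) →
             Eval α (c (α y)) b → Eval α a b
  eval-dec {α} {y = y} c e ev = next e (subst (λ d → Eval α d _) (chosen (α y)) ev)
    where
    chosen : ∀ β → c β ≡ (if β then c true else c false)
    chosen false = refl
    chosen true  = refl

  path-dec : ∀ {a y xs} (c : Bool → Fin N) → node a ≡ dec y (c false) (c true) → PathVars a xs →
             Σ Bool λ β → Σ (List V) λ xs′ → xs ≡ y ∷ xs′ × PathVars (c β) xs′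
  path-dec c e (atSink e′) = ⊥-elim (dec≢sink (trans (sym e) e′))
  path-dec c e (go₀ e′ p) with trans (sym e) e′
  ... | refl = false , _ , refl , p
  path-dec c e (go₁ e′ p) with trans (sym e) e′
  ... | refl = true , _ , refl , p

  path-sink : ∀ {a b xs} → node a ≡ sink b → PathVars a xs → xs ≡ []
  path-sink e (atSink _)  = refl
  path-sink e (go₀ e′ _) = ⊥-elim (dec≢sink (trans (sym e′) e))
  path-sink e (go₁ e′ _) = ⊥-elim (dec≢sink (trans (sym e′) e))

  eval⇒reach-sink : ∀ {α a b} → Eval α a b → Σ (Fin N) λ c → node c ≡ sink b × Reach a c
  eval⇒reach-sink (stop e) = _ , e , here
  eval⇒reach-sink {α} (next {x = x} {l} {h} e ev) with eval⇒reach-sink ev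
  ... | c , e′ , r = c , e′ , step (edge-dec (λ β → if β then h else l) e (α x)) r

mapNode : ∀ {V : Set} {m n} → (Fin m → Fin n) → Node V m → Node V n
mapNode f (sink b)    = sink b
mapNode f (dec x l h) = dec x (f l) (f h)

module Embedding {V : Set} {m n : ℕ} (f : Fin m → Fin n)
  (node₁ : Fin m → Node V m) (node₂ : Fin n → Node V n)
  (hom : ∀ a → node₂ (f a) ≡ mapNode f (node₁ a)) where

  private
    module D₁ = Diagram node₁
    module D₂ = Diagram node₂

    mapNode-sink⁻ : ∀ (nd : Node V m) {b} → mapNode f nd ≡ sink b → nd ≡ sink b
    mapNode-sink⁻ (sink _) refl = refl

    mapNode-dec⁻ : ∀ (nd : Node V m) {x l h} → mapNode f nd ≡ dec x l h →
                   Σ (Fin m) λ l′ → Σ (Fin m) λ h′ → nd ≡ dec x l′ h′ × l ≡ f l′ × h ≡ f h′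
    mapNode-dec⁻ (dec x l′ h′) refl = l′ , h′ , refl , refl , refl

  sink⁺ : ∀ {a b} → node₁ a ≡ sink b → node₂ (f a) ≡ sink b
  sink⁺ {a} e = trans (hom a) (cong (mapNode f) e)

  sink⁻ : ∀ {a b} → node₂ (f a) ≡ sink b → node₁ a ≡ sink b
  sink⁻ {a} e = mapNode-sink⁻ (node₁ a) (trans (sym (hom a)) e)

  dec⁺ : ∀ {a x l h} → node₁ a ≡ dec x l h → node₂ (f a) ≡ dec x (f l) (f h)
  dec⁺ {a} e = trans (hom a) (cong (mapNode f) e)

  edge⁺ : ∀ {a b} → D₁.Edge a b → D₂.Edge (f a) (f b)
  edge⁺ (D₁.edge₀ e) = D₂.edge₀ (dec⁺ e)
  edge⁺ (D₁.edge₁ e) = D₂.edge₁ (dec⁺ e)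

  reach⁺ : ∀ {a b} → D₁.Reach a b → D₂.Reach (f a) (f b)
  reach⁺ D₁.here       = D₂.here
  reach⁺ (D₁.step e r) = D₂.step (edge⁺ e) (reach⁺ r)

  eval⁺ : ∀ {α a b} → D₁.Eval α a b → D₂.Eval α (f a) b
  eval⁺ (D₁.stop e) = D₂.stop (sink⁺ e)
  eval⁺ {α} (D₁.next {x = x} e ev) =
    D₂.next (dec⁺ e) (subst (λ c → D₂.Eval α c _) (Bool.if-float f (α x)) (eval⁺ ev))

  edge⁻ : ∀ {a b} → D₂.Edge (f a) b → Σ (Fin m) λ b′ → b ≡ f b′ × D₁.Edge a b′
  edge⁻ {a} (D₂.edge₀ e) with mapNode-dec⁻ (node₁ a) (trans (sym (hom a)) e)
  ... | l′ , h′ , e′ , refl , refl = l′ , refl , D₁.edge₀ e′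
  edge⁻ {a} (D₂.edge₁ e) with mapNode-dec⁻ (node₁ a) (trans (sym (hom a)) e)
  ... | l′ , h′ , e′ , refl , refl = h′ , refl , D₁.edge₁ e′

  path⁻ : ∀ {a xs} → D₂.PathVars (f a) xs → D₁.PathVars a xs
  path⁻ {a} (D₂.atSink e) = D₁.atSink (sink⁻ e)
  path⁻ {a} (D₂.go₀ e p) with mapNode-dec⁻ (node₁ a) (trans (sym (hom a)) e)
  ... | l′ , h′ , e′ , refl , refl = D₁.go₀ e′ (path⁻ p)
  path⁻ {a} (D₂.go₁ e p) with mapNode-dec⁻ (node₁ a) (trans (sym (hom a)) e)
  ... | l′ , h′ , e′ , refl , refl = D₁.go₁ e′ (path⁻ p)

stack : ∀ {V : Set} {m n} → (Fin m → Node V (m + n)) → (Fin n → Node V n) →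
        Fin (m + n) → Node V (m + n)
stack {m = m} top below = [ top , mapNode (m ↑ʳ_) ∘ below ]′ ∘ splitAt m

stack-↑ˡ : ∀ {V : Set} {m n} top (below : Fin n → Node V n) (i : Fin m) →
           stack top below (i ↑ˡ n) ≡ top i
stack-↑ˡ {m = m} {n} top below i =
  cong [ top , mapNode (m ↑ʳ_) ∘ below ]′ (FP.splitAt-↑ˡ m i n)

stack-↑ʳ : ∀ {V : Set} {m n} (top : Fin m → Node V (m + n)) below (j : Fin n) →
           stack top below (m ↑ʳ j) ≡ mapNode (m ↑ʳ_) (below j)
stack-↑ʳ {m = m} {n} top below j =
  cong [ top , mapNode (m ↑ʳ_) ∘ below ]′ (FP.splitAt-↑ʳ m n j)

module _ {k : ℕ} where

  labelledBy-mapNode : ∀ {m n} (x : Var k) (f : Fin m → Fin n) nd →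
                       labelledBy x (mapNode f nd) ≡ labelledBy x nd
  labelledBy-mapNode x f (sink _) = refl
  labelledBy-mapNode x f (dec y l h) with ≡-dec FP._≟_ FP._≟_ x y
  ... | yes _ = refl
  ... | no _  = refl

  labelledBy≤1 : ∀ {N} (x : Var k) (nd : Node (Var k) N) → labelledBy x nd ≤ 1
  labelledBy≤1 x (sink _) = z≤n
  labelledBy≤1 x (dec y l h) with ≡-dec FP._≟_ FP._≟_ x y
  ... | yes _ = s≤s z≤n
  ... | no _  = z≤n

  labelledBy-dec≢ : ∀ {N} {x y : Var k} → x ≢ y → (l h : Fin N) → labelledBy x (dec y l h) ≡ 0
  labelledBy-dec≢ {x = x} {y} x≢y l h with ≡-dec FP._≟_ FP._≟_ x y
  ... | yes x≡y = ⊥-elim (x≢y x≡y)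
  ... | no _    = refl

module Automaton {k : ℕ} {S : Set} (_≟_ : DecidableEquality S)
  (states : List S) (states-unique : Unique states) (∈-states : ∀ s → s ∈ states)
  (δ : Var k → Bool → S → S) (accept : S → Bool) where

  open DecMembership _≟_ using (_∈?_)

  run : S → List (Var k) → (Var k → Bool) → S
  run s []       α = s
  run s (y ∷ ys) α = run (δ y (α y) s) ys α

  successors : Var k → List S → List S
  successors y L = map (δ y false) L ++ map (δ y true) L

  -- Filtering the duplicate-free list of all states keeps every level duplicate-free, so the node
  -- of a state on a level does not depend on the membership proof it is found by (entry-cong).
  next : Var k → List S → List S
  next y L = filter (_∈? successors y L) states

  next-unique : ∀ y L → Unique (next y L)
  next-unique y L = Unique.filter⁺ (_∈? successors y L) states-unique

  next-length : ∀ y L → length (next y L) ≤ length states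
  next-length y L = List.length-filter (_∈? successors y L) states

  ∈-next⁺ : ∀ {y L s} → s ∈ L → ∀ β → δ y β s ∈ next y L
  ∈-next⁺ {y} {L} p β = ∈-filter⁺ (_∈? successors y L) (∈-states _) (∈-successors β)
    where
    ∈-successors : ∀ β → δ y β _ ∈ successors y L
    ∈-successors false = ∈-++⁺ˡ (∈-map⁺ (δ y false) p)
    ∈-successors true  = ∈-++⁺ʳ (map (δ y false) L) (∈-map⁺ (δ y true) p)

  ∈-next⁻ : ∀ {y L t} → t ∈ next y L → Σ S λ s → s ∈ L × Σ Bool λ β → t ≡ δ y β s
  ∈-next⁻ {y} {L} q
    with ∈-++⁻ (map (δ y false) L) (proj₂ (∈-filter⁻ (_∈? successors y L) {xs = states} q))
  ... | inj₁ r with ∈-map⁻ (δ y false) r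
  ...   | s , p , t≡ = s , p , false , t≡
  ∈-next⁻ {y} q | inj₂ r with ∈-map⁻ (δ y true) r
  ...   | s , p , t≡ = s , p , true , t≡

  -- A level L lists the states the automaton can be in before reading ys; the nodes testing the
  -- head of ys are the positions in L, and the last level is replaced by the two sinks.
  size : List (Var k) → List S → ℕ
  size []       L = 2
  size (y ∷ ys) L = length L + size ys (next y L)

  sinkIndex : Bool → Fin 2
  sinkIndex true  = F.zero
  sinkIndex false = F.suc F.zero

  entry : ∀ ys L {s} → s ∈ L → Fin (size ys L)
  entry []       L {s} _ = sinkIndex (accept s)
  entry (y ∷ ys) L     p = index p ↑ˡ size ys (next y L)

  child : ∀ y ys L → Fin (length L) → Bool → Fin (size (y ∷ ys) L)
  child y ys L i β = length L ↑ʳ entry ys (next y L) (∈-next⁺ (∈-lookup {xs = L} i) β)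

  top : ∀ y ys L → Fin (length L) → Node (Var k) (size (y ∷ ys) L)
  top y ys L i = dec y (child y ys L i false) (child y ys L i true)

  node : ∀ ys L → Fin (size ys L) → Node (Var k) (size ys L)
  node []       L F.zero    = sink true
  node []       L (F.suc _) = sink false
  node (y ∷ ys) L = stack (top y ys L) (node ys (next y L))

  node-↑ˡ : ∀ y ys L i → node (y ∷ ys) L (i ↑ˡ size ys (next y L)) ≡ top y ys L i
  node-↑ˡ y ys L = stack-↑ˡ _ (node ys (next y L))

  module Below y ys L =
    Embedding (length L ↑ʳ_) (node ys (next y L)) (node (y ∷ ys) L) (stack-↑ʳ _ _)

  node-[]-sink : ∀ L a → Σ Bool λ b → node [] L a ≡ sink b
  node-[]-sink L F.zero    = true , refl
  node-[]-sink L (F.suc _) = false , refl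

  node-[]-sink⁻ : ∀ L {a b} → node [] L a ≡ sink b → a ≡ sinkIndex b
  node-[]-sink⁻ L {F.zero}       refl = refl
  node-[]-sink⁻ L {F.suc F.zero} refl = refl

  node-sinkIndex : ∀ L b → node [] L (sinkIndex b) ≡ sink b
  node-sinkIndex L true  = refl
  node-sinkIndex L false = refl

  entry-cong : ∀ ys {L s t} → Unique L → s ≡ t → (p : s ∈ L) (q : t ∈ L) →
               entry ys L p ≡ entry ys L q
  entry-cong []       u refl p q = refl
  entry-cong (y ∷ ys) u refl p q = cong (λ r → index r ↑ˡ _) (unique⇒irrelevant u p q)

  eval : ∀ ys L {s} (p : s ∈ L) α →
         Diagram.Eval (node ys L) α (entry ys L p) (accept (run s ys α))
  eval []       L {s} p α = Diagram.stop (node-sinkIndex L (accept s))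
  eval (y ∷ ys) L {s} p α = eval-dec (child y ys L i) (node-↑ˡ y ys L i)
    (subst (λ t → Diagram.Eval (node (y ∷ ys) L) α (child y ys L i (α y))
                                (accept (run (δ y (α y) t) ys α)))
           (sym (lookup-index p))
           (Below.eval⁺ y ys L (eval ys (next y L) (∈-next⁺ (∈-lookup {xs = L} i) (α y)) α)))
    where i = index p

  paths : ∀ ys L {s} (p : s ∈ L) {xs} →
          Diagram.PathVars (node ys L) (entry ys L p) xs → xs ≡ ys
  paths []       L {s} p pv = path-sink (node-sinkIndex L (accept s)) pv
  paths (y ∷ ys) L p pv with path-dec (child y ys L (index p)) (node-↑ˡ y ys L (index p)) pv
  ... | β , xs′ , refl , pv′ = cong (y ∷_) (paths ys (next y L) _ (Below.path⁻ y ys L pv′))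

  edge-increasing : ∀ ys L {a b} → Diagram.Edge (node ys L) a b → toℕ a < toℕ b
  edge-increasing []       L {F.zero}  (Diagram.edge₀ ())
  edge-increasing []       L {F.zero}  (Diagram.edge₁ ())
  edge-increasing []       L {F.suc _} (Diagram.edge₀ ())
  edge-increasing []       L {F.suc _} (Diagram.edge₁ ())
  edge-increasing (y ∷ ys) L {a} e with split (length L) (size ys (next y L)) a
  ... | left i with edge-dec⁻ (child y ys L i) (node-↑ˡ y ys L i) e
  ...   | β , refl = begin-strict
    toℕ (i ↑ˡ _)                    ≡⟨ FP.toℕ-↑ˡ i _ ⟩
    toℕ i                           <⟨ FP.toℕ<n i ⟩
    length L                        ≤⟨ m≤m+n (length L) _ ⟩
    length L + toℕ (entry ys _ _)   ≡⟨ FP.toℕ-↑ʳ (length L) _ ⟨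
    toℕ (child y ys L i β)          ∎
    where open ≤-Reasoning
  edge-increasing (y ∷ ys) L e | right j with Below.edge⁻ y ys L e
  ... | b , refl , e′ = begin-strict
    toℕ (length L ↑ʳ j)  ≡⟨ FP.toℕ-↑ʳ (length L) j ⟩
    length L + toℕ j     <⟨ +-monoʳ-< (length L) (edge-increasing ys (next y L) e′) ⟩
    length L + toℕ b     ≡⟨ FP.toℕ-↑ʳ (length L) b ⟨
    toℕ (length L ↑ʳ b)  ∎
    where open ≤-Reasoning

  sink-unique : ∀ ys L {a c b} → node ys L a ≡ sink b → node ys L c ≡ sink b → a ≡ c
  sink-unique []       L ea ec = trans (node-[]-sink⁻ L ea) (sym (node-[]-sink⁻ L ec))
  sink-unique (y ∷ ys) L {a} {c} ea ec
    with split (length L) (size ys (next y L)) a | split (length L) (size ys (next y L)) c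
  ... | left i  | _        = ⊥-elim (dec≢sink (trans (sym (node-↑ˡ y ys L i)) ea))
  ... | right _ | left i   = ⊥-elim (dec≢sink (trans (sym (node-↑ˡ y ys L i)) ec))
  ... | right j | right j′ = cong (length L ↑ʳ_)
    (sink-unique ys (next y L) (Below.sink⁻ y ys L ea) (Below.sink⁻ y ys L ec))

  reachable : ∀ ys L → Unique L → ∀ a →
              (Σ Bool λ b → node ys L a ≡ sink b) ⊎
              (Σ S λ s → Σ (s ∈ L) λ p → Diagram.Reach (node ys L) (entry ys L p) a)
  reachable []       L u a = inj₁ (node-[]-sink L a)
  reachable (y ∷ ys) L u a with split (length L) (size ys (next y L)) a
  ... | left i = inj₂ (lookup L i , ∈-lookup i ,
    subst (λ c → Diagram.Reach (node (y ∷ ys) L) (c ↑ˡ _) (i ↑ˡ _))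
          (sym (index-∈-lookup L i)) Diagram.here)
  ... | right j with reachable ys (next y L) (next-unique y L) j
  ...   | inj₁ (b , e) = inj₁ (b , Below.sink⁺ y ys L e)
  ...   | inj₂ (t , q , r) with ∈-next⁻ {y} q
  ...     | s , p , β , refl = inj₂ (s , p , Diagram.step
    (edge-dec (child y ys L (index p)) (node-↑ˡ y ys L (index p)) β)
    (subst (λ c → Diagram.Reach (node (y ∷ ys) L) (length L ↑ʳ c) (length L ↑ʳ j))
           (entry-cong ys (next-unique y L) (cong (δ y β) (lookup-index p)) q _)
           (Below.reach⁺ y ys L r)))

  countIn : ∀ ys L → Var k → ℕ
  countIn ys L x = sumFin (size ys L) (λ a → labelledBy x (node ys L a))

  labelledBy-top≢ : ∀ {x} y ys L → x ≢ y → ∀ i → labelledBy x (top y ys L i) ≡ 0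
  labelledBy-top≢ y ys L x≢y i =
    labelledBy-dec≢ x≢y (child y ys L i false) (child y ys L i true)

  countIn-∷ : ∀ y ys L x → countIn (y ∷ ys) L x ≡
              sumFin (length L) (labelledBy x ∘ top y ys L) + countIn ys (next y L) x
  countIn-∷ y ys L x =
    trans (sumFin-+ (length L) (size ys (next y L)) (labelledBy x ∘ node (y ∷ ys) L))
          (cong₂ _+_ (sumFin-cong (length L) (cong (labelledBy x) ∘ node-↑ˡ y ys L))
                     (sumFin-cong (size ys (next y L)) below))
    where
    below : ∀ j → labelledBy x (node (y ∷ ys) L (length L ↑ʳ j)) ≡
                  labelledBy x (node ys (next y L) j)
    below j = trans (cong (labelledBy x) (stack-↑ʳ _ (node ys (next y L)) j))
                    (labelledBy-mapNode x (length L ↑ʳ_) (node ys (next y L) j))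

  countIn-∉ : ∀ ys L {x} → x ∉ ys → countIn ys L x ≡ 0
  countIn-∉ []       L x∉ = refl
  countIn-∉ (y ∷ ys) L {x} x∉ = trans (countIn-∷ y ys L x) (cong₂ _+_
    (sumFin-zero (length L) (labelledBy-top≢ y ys L (x∉ ∘ here)))
    (countIn-∉ ys (next y L) (x∉ ∘ there)))

  countIn-≤ : ∀ ys L x → Unique ys → length L ≤ length states → countIn ys L x ≤ length states
  countIn-≤ []       L x u L≤ = z≤n
  countIn-≤ (y ∷ ys) L x (y∉ys ∷ u) L≤ with ≡-dec FP._≟_ FP._≟_ x y
  ... | yes refl = begin
    countIn (x ∷ ys) L x             ≡⟨ countIn-∷ x ys L x ⟩
    tops + countIn ys (next x L) x   ≡⟨ cong (tops +_) (countIn-∉ ys _ (All¬⇒¬Any y∉ys)) ⟩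
    tops + 0                         ≡⟨ +-identityʳ tops ⟩
    tops                             ≤⟨ sumFin-≤ (length L) (labelledBy≤1 x ∘ top x ys L) ⟩
    length L                         ≤⟨ L≤ ⟩
    length states                    ∎
    where
    open ≤-Reasoning
    tops = sumFin (length L) (labelledBy x ∘ top x ys L)
  ... | no x≢y = begin
    countIn (y ∷ ys) L x             ≡⟨ countIn-∷ y ys L x ⟩
    tops + countIn ys (next y L) x   ≡⟨ cong (_+ countIn ys (next y L) x) tops≡0 ⟩
    countIn ys (next y L) x          ≤⟨ countIn-≤ ys (next y L) x u (next-length y L) ⟩
    length states                    ∎
    where
    open ≤-Reasoning
    tops = sumFin (length L) (labelledBy x ∘ top y ys L)
    tops≡0 = sumFin-zero (length L) (labelledBy-top≢ y ys L x≢y)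

  NonConstant : S → List (Var k) → Set
  NonConstant s₀ ys = ∀ b → Σ (Var k → Bool) λ α → accept (run s₀ ys α) ≡ b

  diagram : ∀ s₀ ys → NonConstant s₀ ys → BDD (Var k)
  diagram s₀ ys nonConstant = record
    { N         = size ys [ s₀ ]
    ; node      = node ys [ s₀ ]
    ; root      = entry ys [ s₀ ] (here refl)
    ; rank      = λ a → size ys [ s₀ ] ∸ toℕ a
    ; rank-dec  = λ e → ∸-monoʳ-< (edge-increasing ys [ s₀ ] e) (FP.toℕ≤n _)
    ; source    = source
    ; sink-uniq = sink-unique ys [ s₀ ]
    }
    where
    open Diagram (node ys [ s₀ ])
    source : ∀ a → Reach (entry ys [ s₀ ] (here refl)) a
    source a with reachable ys [ s₀ ] ([] ∷ []) a
    ... | inj₂ (_ , here refl , r) = r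
    ... | inj₁ (b , e) with nonConstant b
    ...   | α , refl with eval⇒reach-sink (eval ys [ s₀ ] (here refl) α)
    ...     | c , e′ , r = subst (Reach _) (sink-unique ys [ s₀ ] e′ e) r

  module DiagramProperties (s₀ : S) (ys : List (Var k)) (nonConstant : NonConstant s₀ ys) where
    open BDD (diagram s₀ ys nonConstant) using (root; PathVars; Eval)

    diagram-paths : ∀ xs → PathVars root xs → xs ≡ ys
    diagram-paths xs = paths ys [ s₀ ] (here refl)

    diagram-eval : ∀ α → Eval α root (accept (run s₀ ys α))
    diagram-eval = eval ys [ s₀ ] (here refl)

    diagram-width : Unique ys → ∀ x → count (diagram s₀ ys nonConstant) x ≤ length states
    diagram-width u x = countIn-≤ ys [ s₀ ] x u (∈⇒length>0 (∈-states s₀))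

module _ {k : ℕ} (π : TotalOrder k) where
  private
    module π⁻¹ = Inverse (Bijection⇒Inverse π)

  inOrder : List (Var k)
  inOrder = tabulate π⁻¹.from

  inOrder-linked : Linked (λ x y → x <[ π ] y) inOrder
  inOrder-linked = AllPairs⇒Linked (tabulate⁺-< λ {i} {j} i<j →
    subst₂ F._<_ (sym (π⁻¹.strictlyInverseˡ i)) (sym (π⁻¹.strictlyInverseˡ j)) i<j)

  inOrder-unique : Unique inOrder
  inOrder-unique = Unique.tabulate⁺ λ {i} {j} e →
    trans (sym (π⁻¹.strictlyInverseˡ i)) (trans (cong (pos π) e) (π⁻¹.strictlyInverseˡ j))

  ∈-inOrder : ∀ x → x ∈ inOrder
  ∈-inOrder x = subst (_∈ inOrder) (π⁻¹.strictlyInverseʳ x) (∈-tabulate (pos π x))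

allVars : ∀ k → List (Var k)
allVars k = map inj₁ (allFin k) ++ map inj₂ (allFin k)

allVars-unique : ∀ k → Unique (allVars k)
allVars-unique k = Unique.++⁺ (Unique.map⁺ inj₁-injective (Unique.allFin⁺ k))
                              (Unique.map⁺ inj₂-injective (Unique.allFin⁺ k)) disjoint
  where
  disjoint : ∀ {x} → ¬ (x ∈ map inj₁ (allFin k) × x ∈ map inj₂ (allFin k))
  disjoint (p , q) with ∈-map⁻ inj₁ p | ∈-map⁻ inj₂ q
  ... | _ , _ , refl | _ , _ , ()

∈-allVars : ∀ {k} x → x ∈ allVars k
∈-allVars {k} (inj₁ i) = ∈-++⁺ˡ (∈-map⁺ inj₁ (∈-allFin i))
∈-allVars {k} (inj₂ i) = ∈-++⁺ʳ (map inj₁ (allFin k)) (∈-map⁺ inj₂ (∈-allFin i))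

↭-allVars : ∀ {k} {xs : List (Var k)} → Unique xs → (∀ x → x ∈ xs) → xs ↭ allVars k
↭-allVars {k} u ∈xs =
  ∼bag⇒↭ (unique∧set⇒bag u (allVars-unique k) (mk⇔ (λ _ → ∈-allVars _) (λ _ → ∈xs _)))

sum-↭-allVars : ∀ {k} {xs : List (Var k)} (h : Var k → ℕ) → xs ↭ allVars k →
                sum (map h xs) ≡ sumFin k (h ∘ inj₁) + sumFin k (h ∘ inj₂)
sum-↭-allVars {k} {xs} h xs↭ = begin
  sum (map h xs)                                ≡⟨ sum-↭ (Perm.map⁺ h xs↭) ⟩
  sum (map h (map inj₁ all ++ map inj₂ all))    ≡⟨ cong sum (List.map-++ h (map inj₁ all) _) ⟩
  sum (map h (map inj₁ all) ++ map h (map inj₂ all))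
    ≡⟨ sum-++ (map h (map inj₁ all)) _ ⟩
  sum (map h (map inj₁ all)) + sum (map h (map inj₂ all))
    ≡⟨ cong₂ _+_ (cong sum (List.map-∘ all)) (cong sum (List.map-∘ all)) ⟨
  sumFin k (h ∘ inj₁) + sumFin k (h ∘ inj₂)     ∎
  where
  open ≡-Reasoning
  all = allFin k

State : Set
State = Maybe (Bool × Bool)

pattern ones a c = just (a , c)
pattern tooMany  = nothing

_≟ₛ_ : DecidableEquality State
_≟ₛ_ = Maybe.≡-dec (Product.≡-dec Bool._≟_ Bool._≟_)

states : List State
states = tooMany ∷ ones false false ∷ ones false true ∷ ones true false ∷ ones true true ∷ []

states-unique : Unique states
states-unique = from-yes (unique? states)
  where open import Data.List.Relation.Unary.Unique.DecPropositional _≟ₛ_ using (unique?)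

∈-states : ∀ s → s ∈ states
∈-states tooMany            = here refl
∈-states (ones false false) = there (here refl)
∈-states (ones false true)  = there (there (here refl))
∈-states (ones true false)  = there (there (there (here refl)))
∈-states (ones true true)   = there (there (there (there (here refl))))

tickᵤ tickᵥ : State → State
tickᵤ (ones false c) = ones true c
tickᵤ _              = tooMany
tickᵥ (ones a false) = ones a true
tickᵥ _              = tooMany

transition : ∀ {k} → Var k → Bool → State → State
transition _        false s = s
transition (inj₁ _) true  s = tickᵤ s
transition (inj₂ _) true  s = tickᵥ s

accept : State → Bool
accept (ones false false) = true
accept (ones true true)   = true
accept _                  = false

classOf : ℕ → ℕ → State
classOf 0 0 = ones false false
classOf 0 1 = ones false true
classOf 1 0 = ones true false
classOf 1 1 = ones true true
classOf _ _ = tooMany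

tickᵤ-classOf : ∀ m n → tickᵤ (classOf m n) ≡ classOf (suc m) n
tickᵤ-classOf 0             0             = refl
tickᵤ-classOf 0             1             = refl
tickᵤ-classOf 0             (suc (suc n)) = refl
tickᵤ-classOf 1             0             = refl
tickᵤ-classOf 1             1             = refl
tickᵤ-classOf 1             (suc (suc n)) = refl
tickᵤ-classOf (suc (suc m)) n             = refl

tickᵥ-classOf : ∀ m n → tickᵥ (classOf m n) ≡ classOf m (suc n)
tickᵥ-classOf 0             0             = refl
tickᵥ-classOf 0             1             = refl
tickᵥ-classOf 0             (suc (suc n)) = refl
tickᵥ-classOf 1             0             = refl
tickᵥ-classOf 1             1             = refl
tickᵥ-classOf 1             (suc (suc n)) = refl
tickᵥ-classOf (suc (suc m)) n             = refl

BothOneOrBothZero : ℕ → ℕ → Set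
BothOneOrBothZero m n = (m ≡ 1 × n ≡ 1) ⊎ (m ≡ 0 × n ≡ 0)

accept-classOf : ∀ m n → accept (classOf m n) ≡ true ⇔ BothOneOrBothZero m n
accept-classOf m n = mk⇔ (to m n) from
  where
  to : ∀ m n → accept (classOf m n) ≡ true → BothOneOrBothZero m n
  to 0             0             _ = inj₂ (refl , refl)
  to 1             1             _ = inj₁ (refl , refl)
  to 0             1             ()
  to 0             (suc (suc _)) ()
  to 1             0             ()
  to 1             (suc (suc _)) ()
  to (suc (suc _)) _             ()
  from : BothOneOrBothZero m n → accept (classOf m n) ≡ true
  from (inj₁ (refl , refl)) = refl
  from (inj₂ (refl , refl)) = refl

module EdgeAutomaton {k : ℕ} =
  Automaton {k} _≟ₛ_ states states-unique ∈-states transition accept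

module _ {k : ℕ} where
  open EdgeAutomaton {k} using (run)

  incᵤ incᵥ : Var k → Bool → ℕ
  incᵤ (inj₁ _) β = bit β
  incᵤ (inj₂ _) _ = 0
  incᵥ (inj₁ _) _ = 0
  incᵥ (inj₂ _) β = bit β

  tallyᵤ tallyᵥ : (Var k → Bool) → List (Var k) → ℕ
  tallyᵤ α ys = sum (map (λ y → incᵤ y (α y)) ys)
  tallyᵥ α ys = sum (map (λ y → incᵥ y (α y)) ys)

  onesᵤ onesᵥ : (Var k → Bool) → ℕ
  onesᵤ α = sumFin k (λ i → bit (α (inj₁ i)))
  onesᵥ α = sumFin k (λ i → bit (α (inj₂ i)))

  transition-classOf : ∀ y β m n →
                       transition y β (classOf m n) ≡ classOf (incᵤ y β + m) (incᵥ y β + n)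
  transition-classOf (inj₁ _) false m n = refl
  transition-classOf (inj₁ _) true  m n = tickᵤ-classOf m n
  transition-classOf (inj₂ _) false m n = refl
  transition-classOf (inj₂ _) true  m n = tickᵥ-classOf m n

  run-classOf : ∀ ys m n α →
                run (classOf m n) ys α ≡ classOf (tallyᵤ α ys + m) (tallyᵥ α ys + n)
  run-classOf []       m n α = refl
  run-classOf (y ∷ ys) m n α = begin
    run (transition y (α y) (classOf m n)) ys α
      ≡⟨ cong (λ s → run s ys α) (transition-classOf y (α y) m n) ⟩
    run (classOf (incᵤ y (α y) + m) (incᵥ y (α y) + n)) ys α
      ≡⟨ run-classOf ys _ _ α ⟩
    classOf (tallyᵤ α ys + (incᵤ y (α y) + m)) (tallyᵥ α ys + (incᵥ y (α y) + n))
      ≡⟨ cong₂ classOf (shuffle (tallyᵤ α ys) _ m) (shuffle (tallyᵥ α ys) _ n) ⟩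
    classOf (tallyᵤ α (y ∷ ys) + m) (tallyᵥ α (y ∷ ys) + n)
      ∎
    where
    open ≡-Reasoning
    shuffle : ∀ a b c → a + (b + c) ≡ b + a + c
    shuffle a b c = trans (sym (+-assoc a b c)) (cong (_+ c) (+-comm a b))

  tallyᵤ-↭ : ∀ {ys} → ys ↭ allVars k → ∀ α → tallyᵤ α ys ≡ onesᵤ α
  tallyᵤ-↭ ys↭ α = trans (sum-↭-allVars _ ys↭)
    (trans (cong (onesᵤ α +_) (sumFin-zero k (λ _ → refl))) (+-identityʳ (onesᵤ α)))

  tallyᵥ-↭ : ∀ {ys} → ys ↭ allVars k → ∀ α → tallyᵥ α ys ≡ onesᵥ α
  tallyᵥ-↭ ys↭ α = trans (sum-↭-allVars _ ys↭) (cong (_+ onesᵥ α) (sumFin-zero k (λ _ → refl)))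

  χ⇔ones : ∀ α → χ k α ⇔ BothOneOrBothZero (onesᵤ α) (onesᵥ α)
  χ⇔ones α = mk⇔
    [ inj₁ , (λ none → inj₂ (noneᵤ⁻¹ (proj₁ ∘ none) , noneᵥ⁻¹ (proj₂ ∘ none))) ]′
    [ inj₁ , (λ (Σᵤ≡0 , Σᵥ≡0) → inj₂ λ i → noneᵤ Σᵤ≡0 i , noneᵥ Σᵥ≡0 i) ]′
    where
    open Equivalence (sumFin-bit≡0⇔ k (α ∘ inj₁)) renaming (to to noneᵤ; from to noneᵤ⁻¹)
    open Equivalence (sumFin-bit≡0⇔ k (α ∘ inj₂)) renaming (to to noneᵥ; from to noneᵥ⁻¹)

  accept⇔χ : ∀ {ys} → ys ↭ allVars k → ∀ α → accept (run (classOf 0 0) ys α) ≡ true ⇔ χ k α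
  accept⇔χ {ys} ys↭ α = subst (λ s → accept s ≡ true ⇔ χ k α) (sym run≡)
    (⇔.trans (accept-classOf _ _) (⇔.sym (χ⇔ones α)))
    where
    run≡ : run (classOf 0 0) ys α ≡ classOf (onesᵤ α) (onesᵥ α)
    run≡ = trans (run-classOf ys 0 0 α) (cong₂ classOf
      (trans (+-identityʳ _) (tallyᵤ-↭ ys↭ α)) (trans (+-identityʳ _) (tallyᵥ-↭ ys↭ α)))

  onlyUV : Var k → Bool
  onlyUV = [ (λ _ → true) , (λ _ → false) ]′

  ¬χ-onlyUV : 1 ≤ k → ¬ χ k onlyUV
  ¬χ-onlyUV _ (inj₁ (_ , Σᵥ≡1)) with trans (sym (sumFin-zero k (λ _ → refl))) Σᵥ≡1
  ... | ()
  ¬χ-onlyUV (s≤s z≤n) (inj₂ none) with proj₁ (none F.zero)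
  ... | ()

lemma13 : (n : ℕ) (G : SimpleGraph n) (k : ℕ) → 1 ≤ k →
    (u v : Fin n) → SimpleGraph.Adj G u v →
    (π : TotalOrder k) →
    Σ (BDD (Var k)) λ B →
      IsOBDD π B × IsComplete B × Width≤ B 8 × Represents B (χ k)
lemma13 n G k 1≤k u v adj π =
  diagram (classOf 0 0) ys nonConstant
    , (λ xs p → subst (Linked _) (sym (diagram-paths xs p)) (inOrder-linked π))
    , (λ xs p x → subst (x ∈_) (sym (diagram-paths xs p)) (∈-inOrder π x))
    , (λ x → ≤-trans (diagram-width (inOrder-unique π) x) (m≤m+n 5 3))
    , (λ α → _ , diagram-eval α , accept⇔χ ys↭ α)
  where
  open EdgeAutomaton {k}
  ys = inOrder π
  ys↭ = ↭-allVars (inOrder-unique π) (∈-inOrder π)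
  nonConstant : NonConstant (classOf 0 0) ys
  nonConstant true  = (λ _ → false) , Equivalence.from (accept⇔χ ys↭ _) (inj₂ (λ _ → refl , refl))
  nonConstant false = onlyUV , Bool.¬-not (¬χ-onlyUV 1≤k ∘ Equivalence.to (accept⇔χ ys↭ _))
  open DiagramProperties (classOf 0 0) ys nonConstant
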